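{- Let $K\ge1$ and let $L\subseteq T^K_\Sigma$ be a regular tree language. Then $C(L)=\{C(t):t\in L\}\subseteq\widehat\Sigma^\star$ is a regular word language, and a finite automaton recognising $C(L)$ can be computed from a tree automaton recognising $L$.
   Context: A tree domain is a non-empty finite prefix-closed $D\subseteq\{0,1\}^\star$ with $u0\in D$ iff $u1\in D$ for all $u\in D$; a tree over the finite alphabet $\Sigma$ is a map $t\colon D\to\Sigma$ with $\operatorname{dom}(t)=D$. Thickness is $\max_\ell|\operatorname{dom}(t)\cap\{0,1\}^\ell|$, height $h(t)=\max\{|u|:u\in\operatorname{dom}(t)\}$, and $T^K_\Sigma$ is the set of trees of thickness $\le K$. Regular tree languages are those recognised by deterministic bottom-up tree automata. Encoding: let $\$$ be a new symbol and $\widehat\Sigma=\Sigma\times\{0,1\}\cup\{\$\}$. For $t\in T^K_\Sigma$ with $m=h(t)$, $C(t)=\sigma_0\sigma_1\cdots\sigma_m$ where, with $u_{\ell,1},\dots,u_{\ell,s_\ell}$ the lexicographic (with $0<1$) enumeration of $\operatorname{dom}(t)\cap\{0,1\}^\ell$, $c_{\ell,r}=1$ if $u_{\ell,r}$ has children in $t$ and $c_{\ell,r}=0$ otherwise, and $\sigma_\ell=\langle t(u_{\ell,1}),c_{\ell,1}\rangle\cdots\langle t(u_{\ell,s_\ell}),c_{\ell,s_\ell}\rangle\$^{K-s_\ell}\in\widehat\Sigma^K$. -}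

module Defs where

open import Data.Nat using (ℕ; zero; suc; _∸_; _⊔_)
open import Data.Fin using (Fin)
open import Data.Bool using (Bool; true; false)
open import Data.List using (List; []; _∷_; _++_; map; length; replicate; concat; foldr; foldl; upTo)
open import Data.Product using (_×_; _,_)
open import Relation.Binary.PropositionalEquality using (_≡_)

-- A tree t : D → A with D a tree domain
-- (finite, prefix-closed, u0 ∈ D iff u1 ∈ D) is exactly a finite full
-- binary tree: every node has either no children or both children.
data Tree (A : Set) : Set where
  leaf : A → Tree A
  node : A → Tree A → Tree A → Tree A

height : {A : Set} → Tree A → ℕ
height (leaf _)     = 0
height (node _ l r) = suc (height l ⊔ height r)

-- Nodes of dom(t) ∩ {0,1}^ℓ in lexicographic order (0 < 1), each given
-- as the pair (t(u), c) with c = true iff u has children in t.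
level : {A : Set} → ℕ → Tree A → List (A × Bool)
level zero    (leaf a)     = (a , false) ∷ []
level zero    (node a _ _) = (a , true) ∷ []
level (suc ℓ) (leaf _)     = []
level (suc ℓ) (node _ l r) = level ℓ l ++ level ℓ r

-- thickness = max_ℓ |dom(t) ∩ {0,1}^ℓ|  (levels beyond the height are empty)
thickness : {A : Set} → Tree A → ℕ
thickness t = foldr _⊔_ 0 (map (λ ℓ → length (level ℓ t)) (upTo (suc (height t))))

data Hat (A : Set) : Set where
  ⟨_,_⟩ : A → Bool → Hat A
  $     : Hat A

hatPair : {A : Set} → A × Bool → Hat A
hatPair (a , c) = ⟨ a , c ⟩

σ : {A : Set} → ℕ → Tree A → ℕ → List (Hat A)
σ K t ℓ = map hatPair (level ℓ t) ++ replicate (K ∸ length (level ℓ t)) $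

C : {A : Set} → ℕ → Tree A → List (Hat A)
C K t = concat (map (σ K t) (upTo (suc (height t))))

record DBTA (s : ℕ) : Set where
  field
    nStates : ℕ
    δleaf   : Fin s → Fin nStates
    δnode   : Fin s → Fin nStates → Fin nStates → Fin nStates
    final   : Fin nStates → Bool

runT : {s : ℕ} (M : DBTA s) → Tree (Fin s) → Fin (DBTA.nStates M)
runT M (leaf a)     = DBTA.δleaf M a
runT M (node a l r) = DBTA.δnode M a (runT M l) (runT M r)

AcceptsT : {s : ℕ} → DBTA s → Tree (Fin s) → Set
AcceptsT M t = DBTA.final M (runT M t) ≡ true

record DFA (B : Set) : Set where
  field
    nStates : ℕ
    start   : Fin nStates
    δ       : Fin nStates → B → Fin nStates
    final   : Fin nStates → Bool

runW : {B : Set} (M : DFA B) → List B → Fin (DFA.nStates M)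
runW M w = foldl (DFA.δ M) (DFA.start M) w

AcceptsW : {B : Set} → DFA B → List B → Set
AcceptsW M w = DFA.final M (runW M w) ≡ true

module Submission where

-- C(t) lists the levels of t from the root down, each padded to a block of K symbols.  Reading
-- these blocks top-down, a nondeterministic automaton guesses the states that the bottom-up tree
-- automaton reaches at the nodes of the current level, and checks each block against the guess
-- for the next level: a leaf labelled a must carry the state δleaf a, and an inner node labelled a
-- whose children carry y and z must carry δnode a y z.  As every level has at most K nodes, the
-- guesses are lists of at most K states, so there are finitely many of them; the subset
-- construction and a buffer of K symbols then yield a deterministic automaton on words.

open import Defs
open import Data.Nat using (ℕ; zero; suc; _+_; _∸_; _⊔_; _≤_; _<_; z≤n; s≤s; z<s; s<s; s≤s⁻¹)
open import Data.Nat.Properties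
open import Data.Fin using (Fin)
open import Data.Fin.Properties using () renaming (_≟_ to _≟ᶠ_)
open import Data.Bool using (Bool; true; false; T; _∧_)
open import Data.Bool.Properties using (T-∧; T-≡)
open import Data.Bool.ListAction using (any)
open import Data.List using (List; []; _∷_; _++_; _∷ʳ_; map; length; replicate; concat; concatMap; foldr; foldl; lookup; allFin; null; applyUpTo; upTo; cartesianProduct; cartesianProductWith)
open import Data.List.Properties
open import Data.List.Relation.Unary.Any as Any using (here; there; index)
open import Data.List.Relation.Unary.Any.Properties using (lookup-index; any⁺; any⁻)
open import Data.List.Relation.Unary.All using (All; []; _∷_) renaming (map to All-map)
open import Data.List.Relation.Unary.All.Properties using (applyUpTo⁺₁) renaming (map⁺ to All-map⁺)
open import Data.List.Membership.Propositional using (_∈_; lose)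
open import Data.List.Membership.Propositional.Properties
open import Data.Vec as Vec using (Vec; tabulate)
open import Data.Vec.Properties using (lookup∘tabulate)
open import Data.Product using (Σ; ∃; ∃₂; _×_; _,_; proj₁; proj₂)
open import Data.Sum using (inj₁; inj₂)
open import Function using (_∘_; _⇔_; mk⇔; Equivalence)
open import Function.Properties.Equivalence using () renaming (sym to ⇔-sym)
open import Relation.Nullary using (yes; no; isYes; contradiction)
open import Relation.Nullary.Decidable using (toWitness; fromWitness)
open import Relation.Binary.PropositionalEquality

bools : List Bool
bools = true ∷ false ∷ []

∈-bools : ∀ b → b ∈ bools
∈-bools true  = here refl
∈-bools false = there (here refl)

module _ {A : Set} (as : List A) where

  vectors : ∀ n → List (Vec A n)
  vectors zero    = Vec.[] ∷ []
  vectors (suc n) = cartesianProductWith Vec._∷_ as (vectors n)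

  listsUpTo : ℕ → List (List A)
  listsUpTo zero    = [] ∷ []
  listsUpTo (suc n) = [] ∷ cartesianProductWith _∷_ as (listsUpTo n)

  ∈-listsUpTo⁻ : ∀ {n xs} → xs ∈ listsUpTo n → length xs ≤ n
  ∈-listsUpTo⁻ {zero}  (here refl) = z≤n
  ∈-listsUpTo⁻ {suc n} (here refl) = z≤n
  ∈-listsUpTo⁻ {suc n} (there p) with _ , _ , _ , q , refl ← ∈-cartesianProductWith⁻ _∷_ as (listsUpTo n) p =
    s≤s (∈-listsUpTo⁻ q)

  module _ (∈-as : ∀ a → a ∈ as) where

    ∈-vectors : ∀ {n} (v : Vec A n) → v ∈ vectors n
    ∈-vectors Vec.[]       = here refl
    ∈-vectors (a Vec.∷ v) = ∈-cartesianProductWith⁺ Vec._∷_ (∈-as a) (∈-vectors v)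

    ∈-listsUpTo⁺ : ∀ {n} (xs : List A) → length xs ≤ n → xs ∈ listsUpTo n
    ∈-listsUpTo⁺ {zero}  []       _            = here refl
    ∈-listsUpTo⁺ {suc n} []       _            = here refl
    ∈-listsUpTo⁺ {suc n} (x ∷ xs) (s≤s |xs|≤n) =
      there (∈-cartesianProductWith⁺ _∷_ (∈-as x) (∈-listsUpTo⁺ xs |xs|≤n))

hats : ∀ s → List (Hat (Fin s))
hats s = $ ∷ cartesianProductWith ⟨_,_⟩ (allFin s) bools

∈-hats : ∀ {s} (c : Hat (Fin s)) → c ∈ hats s
∈-hats ⟨ a , b ⟩ = there (∈-cartesianProductWith⁺ ⟨_,_⟩ (∈-allFin a) (∈-bools b))
∈-hats $         = here refl

record FiniteDA (B : Set) : Set₁ where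
  field
    State     : Set
    start     : State
    δ         : State → B → State
    accepting : State → Bool
    states    : List State
    start∈    : start ∈ states
    δ-closed  : ∀ {x} b → x ∈ states → δ x b ∈ states

  run : List B → State
  run = foldl δ start

  Accepts : List B → Set
  Accepts w = T (accepting (run w))

module _ {B : Set} (A : FiniteDA B) where
  open FiniteDA A

  toDFA : DFA B
  toDFA = record
    { nStates = length states
    ; start   = index start∈
    ; δ       = λ i b → index (δ-closed b (∈-lookup i))
    ; final   = accepting ∘ lookup states
    }

  lookup-foldl : ∀ i w → lookup states (foldl (DFA.δ toDFA) i w) ≡ foldl δ (lookup states i) w
  lookup-foldl i []      = refl
  lookup-foldl i (b ∷ w) = trans (lookup-foldl _ w)
    (cong (λ x → foldl δ x w) (sym (lookup-index (δ-closed b (∈-lookup i)))))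

  lookup-runW : ∀ w → lookup states (runW toDFA w) ≡ run w
  lookup-runW w = begin
    lookup states (runW toDFA w)              ≡⟨ lookup-foldl (index start∈) w ⟩
    foldl δ (lookup states (index start∈)) w ≡⟨ cong (λ x → foldl δ x w) (sym (lookup-index start∈)) ⟩
    run w                                     ∎
    where open ≡-Reasoning

  AcceptsW-toDFA : ∀ w → AcceptsW toDFA w ⇔ Accepts w
  AcceptsW-toDFA w = subst (λ x → accepting x ≡ true ⇔ Accepts w) (sym (lookup-runW w)) (⇔-sym T-≡)

record NFA (B : Set) : Set₁ where
  field
    State          : Set
    initial        : State → Bool
    step           : State → B → State → Bool
    accepting      : State → Bool
    states         : List State
    initial-closed : ∀ {x} → T (initial x) → x ∈ states
    step-closed    : ∀ {x b y} → T (step x b y) → y ∈ states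

  data Run : State → List B → State → Set where
    []  : ∀ {x} → Run x [] x
    _∷_ : ∀ {x b y bs z} → T (step x b y) → Run y bs z → Run x (b ∷ bs) z

  Accepts : List B → Set
  Accepts bs = ∃₂ λ x y → T (initial x) × Run x bs y × T (accepting y)

module _ {n : ℕ} (p : Fin n → Bool) where

  any-allFin⁻ : T (any p (allFin n)) → ∃ λ i → T (p i)
  any-allFin⁻ = Any.satisfied ∘ any⁻ p (allFin n)

  any-allFin⁺ : ∀ i → T (p i) → T (any p (allFin n))
  any-allFin⁺ i pi = any⁺ p (lose (∈-allFin i) pi)

module Determinise {B : Set} (A : NFA B) where
  open NFA A

  N : ℕ
  N = length states

  u : Fin N → State
  u = lookup states

  post : Vec Bool N → B → Vec Bool N
  post S b = tabulate λ j → any (λ i → Vec.lookup S i ∧ step (u i) b (u j)) (allFin N)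

  accepting⊆ : Vec Bool N → Bool
  accepting⊆ S = any (λ i → Vec.lookup S i ∧ accepting (u i)) (allFin N)

  post-sound : ∀ bs S → T (accepting⊆ (foldl post S bs)) →
               ∃₂ λ i y → T (Vec.lookup S i) × Run (u i) bs y × T (accepting y)
  post-sound [] S acc with i , Si∧acc ← any-allFin⁻ _ acc
    with Si , acc-i ← Equivalence.to T-∧ Si∧acc = i , u i , Si , [] , acc-i
  post-sound (b ∷ bs) S acc with j , y , Sj , run , acc-y ← post-sound bs (post S b) acc
    with i , Si∧step ← any-allFin⁻ _ (subst T (lookup∘tabulate _ j) Sj)
    with Si , st ← Equivalence.to T-∧ Si∧step = i , y , Si , st ∷ run , acc-y

  post-complete : ∀ bs S i {y} → T (Vec.lookup S i) → Run (u i) bs y → T (accepting y) →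
                  T (accepting⊆ (foldl post S bs))
  post-complete [] S i Si [] acc = any-allFin⁺ _ i (Equivalence.from T-∧ (Si , acc))
  post-complete (b ∷ bs) S i {y} Si (_∷_ {y = x} st run) acc =
    post-complete bs (post S b) j Sj run′ acc
    where
    x∈ : x ∈ states
    x∈ = step-closed st
    j : Fin N
    j = index x∈
    run′ : Run (u j) bs y
    run′ = subst (λ z → Run z bs y) (lookup-index x∈) run
    Sj : T (Vec.lookup (post S b) j)
    Sj = subst T (sym (lookup∘tabulate _ j))
      (any-allFin⁺ _ i (Equivalence.from T-∧ (Si , subst (T ∘ step (u i) b) (lookup-index x∈) st)))

determinise : ∀ {B} → NFA B → FiniteDA B
determinise A = record
  { State     = Vec Bool N
  ; start     = tabulate (initial ∘ u)
  ; δ         = post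
  ; accepting = accepting⊆
  ; states    = vectors bools N
  ; start∈    = ∈-vectors bools ∈-bools _
  ; δ-closed  = λ _ _ → ∈-vectors bools ∈-bools _
  }
  where open NFA A; open Determinise A

Accepts-determinise : ∀ {B} (A : NFA B) bs → FiniteDA.Accepts (determinise A) bs ⇔ NFA.Accepts A bs
Accepts-determinise A bs = mk⇔ sound complete
  where
  open NFA A
  open Determinise A
  sound : FiniteDA.Accepts (determinise A) bs → NFA.Accepts A bs
  sound acc with i , y , init , run , acc-y ← post-sound bs _ acc =
    u i , y , subst T (lookup∘tabulate _ i) init , run , acc-y
  complete : NFA.Accepts A bs → FiniteDA.Accepts (determinise A) bs
  complete (x , y , init , run , acc-y) =
    post-complete bs _ i (subst T (sym (lookup∘tabulate _ i)) (subst (T ∘ initial) (lookup-index x∈) init))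
      (subst (λ z → Run z bs y) (lookup-index x∈) run) acc-y
    where
    x∈ : x ∈ states
    x∈ = initial-closed init
    i : Fin N
    i = index x∈

length-∷ʳ : ∀ {A : Set} (xs : List A) x → length (xs ∷ʳ x) ≡ suc (length xs)
length-∷ʳ xs x = trans (length-++ xs) (+-comm (length xs) 1)

module Buffer {Sym Y : Set} (k : ℕ) (δ : Y → List Sym → Y) where

  push : Y × List Sym → Sym → Y × List Sym
  push (y , buf) c with length buf ≟ k
  ... | yes _ = δ y (buf ∷ʳ c) , []
  ... | no  _ = y , buf ∷ʳ c

  push-sound : ∀ w {y buf} → length buf ≤ k →
               ∃₂ λ bs r → All (λ b → length b ≡ suc k) bs
                         × buf ++ w ≡ concat bs ++ r
                         × foldl push (y , buf) w ≡ (foldl δ y bs , r)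
  push-sound [] {y} {buf} _ = [] , buf , [] , ++-identityʳ buf , refl
  push-sound (c ∷ w) {y} {buf} |buf|≤k with length buf ≟ k
  ... | yes |buf|≡k with bs , r , |bs| , w≡ , run≡ ← push-sound w {δ y (buf ∷ʳ c)} {[]} z≤n =
    (buf ∷ʳ c) ∷ bs , r , trans (length-∷ʳ buf c) (cong suc |buf|≡k) ∷ |bs| ,
    trans (sym (++-assoc buf (c ∷ []) w))
          (trans (cong (buf ∷ʳ c ++_) w≡) (sym (++-assoc (buf ∷ʳ c) (concat bs) r))) ,
    run≡
  ... | no |buf|≢k with bs , r , |bs| , w≡ , run≡ ←
          push-sound w {y} {buf ∷ʳ c} (subst (_≤ k) (sym (length-∷ʳ buf c)) (≤∧≢⇒< |buf|≤k |buf|≢k)) =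
    bs , r , |bs| , trans (sym (++-assoc buf (c ∷ []) w)) w≡ , run≡

  push-block : ∀ β {y buf c} → length buf + suc (length β) ≡ suc k →
               foldl push (y , buf) (c ∷ β) ≡ (δ y (buf ++ c ∷ β) , [])
  push-block [] {buf = buf} e with length buf ≟ k
  ... | yes _      = refl
  ... | no |buf|≢k = contradiction (suc-injective (trans (+-comm 1 (length buf)) e)) |buf|≢k
  push-block (c′ ∷ β) {y} {buf} {c} e with length buf ≟ k
  ... | yes refl = contradiction (suc-injective (trans (sym (+-suc k _)) e)) (m+1+n≢m k)
  ... | no _ = trans (push-block β {y} {buf ∷ʳ c} {c′} e′)
                     (cong (λ b → δ y b , []) (++-assoc buf (c ∷ []) (c′ ∷ β)))
    where
    e′ : length (buf ∷ʳ c) + suc (length β) ≡ suc k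
    e′ = trans (cong (_+ suc (length β)) (length-∷ʳ buf c)) (trans (sym (+-suc (length buf) _)) e)

  push-blocks : ∀ bs {y} → All (λ b → length b ≡ suc k) bs →
                foldl push (y , []) (concat bs) ≡ (foldl δ y bs , [])
  push-blocks [] [] = refl
  push-blocks ((c ∷ β) ∷ bs) {y} (|cβ| ∷ |bs|) =
    trans (foldl-++ push (y , []) (c ∷ β) (concat bs))
          (trans (cong (λ z → foldl push z (concat bs)) (push-block β |cβ|)) (push-blocks bs |bs|))

module _ {Sym : Set} (k : ℕ) (syms : List Sym) (∈-syms : ∀ c → c ∈ syms) (A : FiniteDA (List Sym)) where
  open FiniteDA A
  open Buffer k δ

  private
    buffers : List (List Sym)
    buffers = listsUpTo syms k

    acceptingBuffered : State × List Sym → Bool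
    acceptingBuffered (x , buf) = accepting x ∧ null buf

    push-closed : ∀ {x buf} c → (x , buf) ∈ cartesianProduct states buffers →
                  push (x , buf) c ∈ cartesianProduct states buffers
    push-closed {x} {buf} c p with x∈ , buf∈ ← ∈-cartesianProduct⁻ states buffers p | length buf ≟ k
    ... | yes _      = ∈-cartesianProduct⁺ (δ-closed _ x∈) (∈-listsUpTo⁺ syms ∈-syms [] z≤n)
    ... | no |buf|≢k = ∈-cartesianProduct⁺ x∈ (∈-listsUpTo⁺ syms ∈-syms (buf ∷ʳ c)
      (subst (_≤ k) (sym (length-∷ʳ buf c)) (≤∧≢⇒< (∈-listsUpTo⁻ syms buf∈) |buf|≢k)))

  AcceptedInBlocks : List Sym → Set
  AcceptedInBlocks w = ∃ λ bs → All (λ b → length b ≡ suc k) bs × w ≡ concat bs × Accepts bs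

  unblock : FiniteDA Sym
  unblock = record
    { State     = State × List Sym
    ; start     = start , []
    ; δ         = push
    ; accepting = acceptingBuffered
    ; states    = cartesianProduct states buffers
    ; start∈    = ∈-cartesianProduct⁺ start∈ (∈-listsUpTo⁺ syms ∈-syms [] z≤n)
    ; δ-closed  = push-closed
    }

  Accepts-unblock : ∀ w → FiniteDA.Accepts unblock w ⇔ AcceptedInBlocks w
  Accepts-unblock w = mk⇔ sound complete
    where
    sound : FiniteDA.Accepts unblock w → AcceptedInBlocks w
    sound acc with bs , r , |bs| , w≡ , run≡ ← push-sound w {start} {[]} z≤n
      with acc-bs , null-r ← Equivalence.to T-∧ (subst (T ∘ acceptingBuffered) run≡ acc) =
      bs , |bs| , trans w≡ (trans (cong (concat bs ++_) (null⇒≡[] r null-r)) (++-identityʳ (concat bs))) , acc-bs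
      where
      null⇒≡[] : ∀ (xs : List Sym) → T (null xs) → xs ≡ []
      null⇒≡[] [] _ = refl
    complete : AcceptedInBlocks w → FiniteDA.Accepts unblock w
    complete (bs , |bs| , refl , acc) =
      subst (T ∘ acceptingBuffered) (sym (push-blocks bs |bs|)) (Equivalence.from T-∧ (acc , _))

applyUpTo-cong : ∀ {A : Set} {f g : ℕ → A} n → (∀ ℓ → f ℓ ≡ g ℓ) → applyUpTo f n ≡ applyUpTo g n
applyUpTo-cong zero    f≗g = refl
applyUpTo-cong (suc n) f≗g = cong₂ _∷_ (f≗g 0) (applyUpTo-cong n (f≗g ∘ suc))

≤-foldr-⊔ : ∀ {m ms} → m ∈ ms → m ≤ foldr _⊔_ 0 ms
≤-foldr-⊔ (here refl) = m≤m⊔n _ _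
≤-foldr-⊔ {ms = m′ ∷ _} (there p) = ≤-trans (≤-foldr-⊔ p) (m≤n⊔m m′ _)

module _ {A : Set} where

  forestLevel : ℕ → List (Tree A) → List (A × Bool)
  forestLevel ℓ = concatMap (level ℓ)

  roots : List (Tree A) → List (A × Bool)
  roots = forestLevel 0

  children : List (Tree A) → List (Tree A)
  children []                = []
  children (leaf _ ∷ ts)     = children ts
  children (node _ l r ∷ ts) = l ∷ r ∷ children ts

  forestLevel-children : ∀ ℓ ts → forestLevel (suc ℓ) ts ≡ forestLevel ℓ (children ts)
  forestLevel-children ℓ []                = refl
  forestLevel-children ℓ (leaf _ ∷ ts)     = forestLevel-children ℓ ts
  forestLevel-children ℓ (node _ l r ∷ ts) =
    trans (++-assoc (level ℓ l) (level ℓ r) _)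
          (cong (λ L → level ℓ l ++ level ℓ r ++ L) (forestLevel-children ℓ ts))

  length-roots : ∀ ts → length (roots ts) ≡ length ts
  length-roots []                = refl
  length-roots (leaf _ ∷ ts)     = cong suc (length-roots ts)
  length-roots (node _ _ _ ∷ ts) = cong suc (length-roots ts)

  roots-empty : ∀ ts → roots ts ≡ [] → ts ≡ []
  roots-empty []                _  = refl
  roots-empty (leaf _ ∷ _)     ()
  roots-empty (node _ _ _ ∷ _) ()

  level-empty : ∀ ℓ (t : Tree A) → height t < ℓ → level ℓ t ≡ []
  level-empty (suc ℓ) (leaf _)     _ = refl
  level-empty (suc ℓ) (node _ l r) (s≤s h<ℓ) =
    cong₂ _++_ (level-empty ℓ l (m⊔n<o⇒m<o (height l) (height r) h<ℓ))
               (level-empty ℓ r (m⊔n<o⇒n<o (height l) (height r) h<ℓ))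

  level-nonempty : ∀ ℓ (t : Tree A) → ℓ ≤ height t → level ℓ t ≢ []
  level-nonempty zero    (leaf _)     _ ()
  level-nonempty zero    (node _ _ _) _ ()
  level-nonempty (suc ℓ) (node _ l r) (s≤s ℓ≤h) with ⊔-sel (height l) (height r)
  ... | inj₁ h≡hl = level-nonempty ℓ l (subst (ℓ ≤_) h≡hl ℓ≤h) ∘ ++-conicalˡ (level ℓ l) _
  ... | inj₂ h≡hr = level-nonempty ℓ r (subst (ℓ ≤_) h≡hr ℓ≤h) ∘ ++-conicalʳ (level ℓ l) _

  level-≤-thickness : ∀ ℓ (t : Tree A) → ℓ ≤ height t → length (level ℓ t) ≤ thickness t
  level-≤-thickness ℓ t ℓ≤h = ≤-foldr-⊔ (∈-map⁺ (λ ℓ → length (level ℓ t)) (∈-upTo⁺ (s≤s ℓ≤h)))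

  data Levels : List (Tree A) → List (List (A × Bool)) → Set where
    []   : Levels [] []
    next : ∀ {t ts Ls} → Levels (children (t ∷ ts)) Ls → Levels (t ∷ ts) (roots (t ∷ ts) ∷ Ls)

  Levels-functional : ∀ {ts Ls Ls′} → Levels ts Ls → Levels ts Ls′ → Ls ≡ Ls′
  Levels-functional []       []        = refl
  Levels-functional (next p) (next p′) = cong (_ ∷_) (Levels-functional p p′)

  Levels-applyUpTo : ∀ n ts → (∀ {ℓ} → ℓ < n → forestLevel ℓ ts ≢ []) → forestLevel n ts ≡ [] →
                     Levels ts (applyUpTo (λ ℓ → forestLevel ℓ ts) n)
  Levels-applyUpTo zero ts _ empty rewrite roots-empty ts empty = []
  Levels-applyUpTo (suc n) []       nonempty _ = contradiction refl (nonempty z<s)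
  Levels-applyUpTo (suc n) (t ∷ ts) nonempty empty =
    next (subst (Levels (children (t ∷ ts)))
                (applyUpTo-cong n (λ ℓ → sym (forestLevel-children ℓ (t ∷ ts))))
                (Levels-applyUpTo n (children (t ∷ ts))
                   (λ ℓ<n → subst (_≢ []) (forestLevel-children _ (t ∷ ts)) (nonempty (s<s ℓ<n)))
                   (trans (sym (forestLevel-children n (t ∷ ts))) empty)))

  levels : Tree A → List (List (A × Bool))
  levels t = applyUpTo (λ ℓ → level ℓ t) (suc (height t))

  Levels-levels : ∀ t → Levels (t ∷ []) (levels t)
  Levels-levels t =
    subst (Levels (t ∷ [])) (applyUpTo-cong (suc (height t)) (λ ℓ → ++-identityʳ (level ℓ t)))
      (Levels-applyUpTo (suc (height t)) (t ∷ [])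
        (λ {ℓ} ℓ<1+h → level-nonempty ℓ t (s≤s⁻¹ ℓ<1+h) ∘ ++-conicalˡ (level ℓ t) [])
        (cong (_++ []) (level-empty (suc (height t)) t ≤-refl)))

  levels-bounded : ∀ {K} t → thickness t ≤ K → All (λ L → length L ≤ K) (levels t)
  levels-bounded t thin = applyUpTo⁺₁ (λ ℓ → level ℓ t) (suc (height t))
    (λ ℓ<1+h → ≤-trans (level-≤-thickness _ t (s≤s⁻¹ ℓ<1+h)) thin)

  length-≤-Levels : ∀ {K ts Ls} → Levels ts Ls → All (λ L → length L ≤ K) Ls → length ts ≤ K
  length-≤-Levels []                   []           = z≤n
  length-≤-Levels (next {t} {ts} _) (|L|≤K ∷ _) = subst (_≤ _) (length-roots (t ∷ ts)) |L|≤K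

pad : ∀ {A : Set} → ℕ → List (A × Bool) → List (Hat A)
pad K ps = map hatPair ps ++ replicate (K ∸ length ps) $

length-pad : ∀ {A : Set} K (ps : List (A × Bool)) → length ps ≤ K → length (pad K ps) ≡ K
length-pad K ps |ps|≤K = begin
  length (pad K ps)                                              ≡⟨ length-++ (map hatPair ps) ⟩
  length (map hatPair ps) + length (replicate (K ∸ length ps) $) ≡⟨ cong₂ _+_ (length-map hatPair ps)
                                                                                 (length-replicate _) ⟩
  length ps + (K ∸ length ps)                                    ≡⟨ m+[n∸m]≡n |ps|≤K ⟩
  K                                                              ∎
  where open ≡-Reasoning

C-levels : ∀ {A : Set} K (t : Tree A) → C K t ≡ concat (map (pad K) (levels t))
C-levels K t = cong concat (begin
  map (σ K t) (upTo (suc (height t)))          ≡⟨ map-upTo (σ K t) (suc (height t)) ⟩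
  applyUpTo (σ K t) (suc (height t))           ≡⟨ map-applyUpTo (λ ℓ → level ℓ t) (pad K) (suc (height t)) ⟨
  map (pad K) (levels t)                       ∎)
  where open ≡-Reasoning

module LevelAutomaton {s : ℕ} (M : DBTA s) (K : ℕ) (1≤K : 1 ≤ K) where
  open DBTA M using (δleaf; δnode) renaming (nStates to Q; final to finalT)

  run : Tree (Fin s) → Fin Q
  run = runT M

  fits : List (Hat (Fin s)) → List (Fin Q) → List (Fin Q) → ℕ → Bool
  fits []                  []       []            zero    = true
  fits ($ ∷ β)             []       []            (suc n) = fits β [] [] n
  fits (⟨ a , false ⟩ ∷ β) (q ∷ qs) qs′           (suc n) = isYes (δleaf a ≟ᶠ q) ∧ fits β qs qs′ n
  fits (⟨ a , true ⟩ ∷ β)  (q ∷ qs) (y ∷ z ∷ qs′) (suc n) = isYes (δnode a y z ≟ᶠ q) ∧ fits β qs qs′ n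
  fits _                   _        _             _       = false

  fits-sound : ∀ β qs qs′ n → T (fits β qs qs′ n) → ∀ ts′ → map run ts′ ≡ qs′ →
               ∃ λ ts → map run ts ≡ qs × children ts ≡ ts′ × pad n (roots ts) ≡ β
  fits-sound [] [] [] zero _ [] refl = [] , refl , refl , refl
  fits-sound ($ ∷ β) [] [] (suc n) ok ts′ e with fits-sound β [] [] n ok ts′ e
  ... | [] , _ , ch , β≡ = [] , refl , ch , cong ($ ∷_) β≡
  fits-sound (⟨ a , false ⟩ ∷ β) (q ∷ qs) qs′ (suc n) ok ts′ e
    with leaf-ok , ok′ ← Equivalence.to T-∧ ok
    with ts , e′ , ch , β≡ ← fits-sound β qs qs′ n ok′ ts′ e =
    leaf a ∷ ts , cong₂ _∷_ (toWitness leaf-ok) e′ , ch , cong (⟨ a , false ⟩ ∷_) β≡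
  fits-sound (⟨ a , true ⟩ ∷ β) (q ∷ qs) (y ∷ z ∷ qs′) (suc n) ok (l ∷ r ∷ ts′) refl
    with node-ok , ok′ ← Equivalence.to T-∧ ok
    with ts , e′ , ch , β≡ ← fits-sound β qs qs′ n ok′ ts′ refl =
    node a l r ∷ ts , cong₂ _∷_ (toWitness node-ok) e′ , cong (λ c → l ∷ r ∷ c) ch , cong (⟨ a , true ⟩ ∷_) β≡

  fits-padding : ∀ n → T (fits (replicate n $) [] [] n)
  fits-padding zero    = _
  fits-padding (suc n) = fits-padding n

  fits-complete : ∀ n ts → length (roots ts) ≤ n →
                  T (fits (pad n (roots ts)) (map run ts) (map run (children ts)) n)
  fits-complete n       []                _           = fits-padding n
  fits-complete (suc n) (leaf a ∷ ts)     (s≤s bound) =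
    Equivalence.from T-∧ (fromWitness refl , fits-complete n ts bound)
  fits-complete (suc n) (node a l r ∷ ts) (s≤s bound) =
    Equivalence.from T-∧ (fromWitness refl , fits-complete n ts bound)

  -- No step leaves the empty level, so an accepting run reads exactly the non-empty levels.
  step : List (Fin Q) → List (Hat (Fin s)) → List (Fin Q) → Bool
  step []           _ _   = false
  step qs@(_ ∷ _) β qs′ = isYes (length qs′ ≤? K) ∧ fits β qs qs′ K

  step-intro : ∀ q qs β qs′ → length qs′ ≤ K → T (fits β (q ∷ qs) qs′ K) → T (step (q ∷ qs) β qs′)
  step-intro _ _ _ qs′ bound ok = Equivalence.from (T-∧ {isYes (length qs′ ≤? K)}) (fromWitness bound , ok)

  step-elim : ∀ q qs β qs′ → T (step (q ∷ qs) β qs′) → length qs′ ≤ K × T (fits β (q ∷ qs) qs′ K)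
  step-elim _ _ _ qs′ ok with bound , ok′ ← Equivalence.to (T-∧ {isYes (length qs′ ≤? K)}) ok =
    toWitness bound , ok′

  initial : List (Fin Q) → Bool
  initial (q ∷ []) = finalT q
  initial _        = false

  levelNFA : NFA (List (Hat (Fin s)))
  levelNFA = record
    { State          = List (Fin Q)
    ; initial        = initial
    ; step           = step
    ; accepting      = null
    ; states         = listsUpTo (allFin Q) K
    ; initial-closed = λ {qs} → initial-closed {qs}
    ; step-closed    = λ {qs} {β} {qs′} → step-closed {qs} {β} {qs′}
    }
    where
    initial-closed : ∀ {qs} → T (initial qs) → qs ∈ listsUpTo (allFin Q) K
    initial-closed {_ ∷ []} _ = ∈-listsUpTo⁺ (allFin Q) ∈-allFin _ 1≤K
    step-closed : ∀ {qs β qs′} → T (step qs β qs′) → qs′ ∈ listsUpTo (allFin Q) K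
    step-closed {q ∷ qs} {β} {qs′} ok = ∈-listsUpTo⁺ (allFin Q) ∈-allFin _ (proj₁ (step-elim q qs β qs′ ok))

  open NFA levelNFA using (Run; []; _∷_; Accepts)

  run-sound : ∀ {qs bs} → Run qs bs [] →
              ∃ λ ts → map run ts ≡ qs × ∃ λ Ls → Levels ts Ls × bs ≡ map (pad K) Ls
  run-sound [] = [] , refl , [] , [] , refl
  run-sound {q ∷ qs} (_∷_ {b = β} {y = qs′} ok run′)
    with ts′ , e′ , Ls , lv , bs≡ ← run-sound run′
    with fits-sound β (q ∷ qs) qs′ K (proj₂ (step-elim q qs β qs′ ok)) ts′ e′
  ... | t ∷ ts , e , ch , β≡ =
    t ∷ ts , e , _ , next (subst (λ c → Levels c Ls) (sym ch) lv) , cong₂ _∷_ (sym β≡) bs≡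

  run-complete : ∀ {ts Ls} → Levels ts Ls → All (λ L → length L ≤ K) Ls → Run (map run ts) (map (pad K) Ls) []
  run-complete []                  []            = []
  run-complete (next {t} {ts} lv) (|L|≤K ∷ bnd) = ok ∷ run-complete lv bnd
    where
    cs : List (Tree (Fin s))
    cs = children (t ∷ ts)
    ok : T (step (map run (t ∷ ts)) (pad K (roots (t ∷ ts))) (map run cs))
    ok = step-intro (run t) (map run ts) (pad K (roots (t ∷ ts))) (map run cs)
      (subst (_≤ K) (sym (length-map run cs)) (length-≤-Levels lv bnd)) (fits-complete K (t ∷ ts) |L|≤K)

  levelNFA-sound : ∀ {bs} → Accepts bs → ∃ λ t → AcceptsT M t × concat bs ≡ C K t
  levelNFA-sound (q ∷ [] , [] , init , r , _) with run-sound r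
  ... | t ∷ [] , refl , Ls , lv , refl =
    t , Equivalence.to T-≡ init ,
    trans (cong (concat ∘ map (pad K)) (Levels-functional lv (Levels-levels t))) (sym (C-levels K t))

  blocks : Tree (Fin s) → List (List (Hat (Fin s)))
  blocks t = map (pad K) (levels t)

  length-blocks : ∀ t → thickness t ≤ K → All (λ b → length b ≡ K) (blocks t)
  length-blocks t thin = All-map⁺ (All-map (λ {L} → length-pad K L) (levels-bounded t thin))

  levelNFA-complete : ∀ t → AcceptsT M t → thickness t ≤ K → Accepts (blocks t)
  levelNFA-complete t acc thin =
    run t ∷ [] , [] , Equivalence.from T-≡ acc , run-complete (Levels-levels t) (levels-bounded t thin) , _

proposition4p4 : (K : ℕ) → 1 ≤ K → (s : ℕ) → (M : DBTA s)
    → (∀ t → AcceptsT M t → thickness t ≤ K)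
    → Σ (DFA (Hat (Fin s))) λ B → (w : List (Hat (Fin s)))
        → (AcceptsW B w → ∃ λ t → AcceptsT M t × C K t ≡ w)
        × ((∃ λ t → AcceptsT M t × C K t ≡ w) → AcceptsW B w)
proposition4p4 (suc k) 1≤K s M thin = toDFA wordDA , λ w → sound w , complete w
  where
  open LevelAutomaton M (suc k) 1≤K
  open Equivalence

  blockDA : FiniteDA (List (Hat (Fin s)))
  blockDA = determinise levelNFA

  wordDA : FiniteDA (Hat (Fin s))
  wordDA = unblock k (hats s) ∈-hats blockDA

  sound : ∀ w → AcceptsW (toDFA wordDA) w → ∃ λ t → AcceptsT M t × C (suc k) t ≡ w
  sound w acc
    with bs , _ , refl , acc-bs ← to (Accepts-unblock k (hats s) ∈-hats blockDA w) (to (AcceptsW-toDFA wordDA w) acc)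
    with t , acc-t , C≡ ← levelNFA-sound (to (Accepts-determinise levelNFA bs) acc-bs) = t , acc-t , sym C≡

  complete : ∀ w → (∃ λ t → AcceptsT M t × C (suc k) t ≡ w) → AcceptsW (toDFA wordDA) w
  complete w (t , acc-t , refl) =
    from (AcceptsW-toDFA wordDA w) (from (Accepts-unblock k (hats s) ∈-hats blockDA w)
      ( blocks t , length-blocks t (thin t acc-t) , C-levels (suc k) t
      , from (Accepts-determinise levelNFA (blocks t)) (levelNFA-complete t acc-t (thin t acc-t))))
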